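{- Let $T$ be a (left or right) concatenation tree and $\alpha_1,\dots,\alpha_t$ its node labels in RCL order, indices modulo $t$. Fix $j$. If $\alpha_j$ is periodic with period $p$ and acceptable range $\{kp+1,\dots,kp+p\}$, then $\mathrm{ap}(\alpha_j)^{n/p-k-1}$ is a suffix of $\alpha_{j-1}$.
   Context: Strings of length $n$ over a finite ordered alphabet. $\mathrm{ap}(\alpha)$ is the shortest $\beta$ with $\alpha=\beta^q$ for some $q\ge1$; $|\beta|$ is the period; $\alpha$ is periodic if its period is less than $n$. A PCR-based cycle-joining tree $\mathcal{T}$ is a rooted tree whose nodes are distinct rotation classes of strings, each named by its lexicographically least rotation (necklace), where the edge from node $u$ to child $v$ is labeled by a conjugate pair $(\mathtt{x}\beta,\mathtt{y}\beta)$ ($\mathtt{x}\neq\mathtt{y}$ symbols, $|\beta|=n-1$) with $\mathtt{x}\beta$ a rotation in $u$ and $\mathtt{y}\beta$ a rotation in $v$; it satisfies the Chain Property if no node has two children with edge labels sharing the same $\beta$. A concatenation tree $\mathrm{concat}(\mathcal{T},c,\ell)$, for such $\mathcal{T}$ with the Chain Property, $c\in\{1,\dots,n\}$, $\ell\in\{\mathit{left},\mathit{right}\}$, has the same nodes and parent relation, each node carrying a label (a rotation in its class) and a change index: the root has label its necklace and change index $c$; if a node has label $\alpha$, change index $c'$ and period $p$, with $jp<c'\le jp+p$, its acceptable range is $\{jp+1,\dots,jp+p\}$; a child joined by $(\mathtt{x}\beta,\mathtt{y}\beta)$ gets label $\beta_1\mathtt{y}\beta_2$ and change index $|\beta_1|+1$,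 where $\alpha=\beta_1\mathtt{x}\beta_2$ is the unique factorization with $\beta_2\beta_1=\beta$ and $|\beta_1|+1$ in the acceptable range. Children with change index $<c'$ are left-children, $>c'$ right-children, and $=c'$ left-children if $\ell=\mathit{left}$, right-children if $\ell=\mathit{right}$; each type ordered by increasing change index. RCL order: recursively, the right-children subtrees first to last, then the node, then the left-children subtrees first to last. -}

module Defs where

open import Data.Nat using (ℕ; zero; suc; _+_; _*_; _∸_; _<_; _≤_; _<ᵇ_; _≤ᵇ_)
open import Data.Nat.DivMod using (_/_)
open import Data.Fin as Fin using (Fin; fromℕ; inject₁)
open import Data.Bool using (Bool; true; false; if_then_else_)
open import Data.List using (List; []; _∷_; _++_; length; take; drop; concat; replicate; map)
open import Data.List.Relation.Binary.Permutation.Propositional using (_↭_)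
open import Data.List.Relation.Unary.Linked using (Linked)
open import Data.List.Relation.Unary.Unique.Propositional using (Unique)
open import Data.Product using (Σ; ∃; ∃-syntax; _×_; _,_)
open import Relation.Binary.PropositionalEquality using (_≡_; _≢_)
open import Relation.Nullary using (¬_)

Str : ℕ → Set
Str σ = List (Fin σ)

rotate : ∀ {A : Set} → ℕ → List A → List A
rotate s xs = drop s xs ++ take s xs

IsRotation : ∀ {A : Set} → List A → List A → Set
IsRotation a b = ∃[ s ] rotate s b ≡ a

data _≤L_ {σ : ℕ} : Str σ → Str σ → Set where
  []≤ : ∀ {ys} → [] ≤L ys
  lt  : ∀ {x y xs ys} → x Fin.< y → (x ∷ xs) ≤L (y ∷ ys)
  eq  : ∀ {x xs ys} → xs ≤L ys → (x ∷ xs) ≤L (x ∷ ys)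

IsNecklace : ∀ {σ} → Str σ → Set
IsNecklace a = ∀ s → a ≤L rotate s a

pow : ∀ {A : Set} → List A → ℕ → List A
pow β q = concat (replicate q β)

IsPeriod : ∀ {A : Set} → List A → ℕ → Set
IsPeriod α p =
  (0 < p) × (∃[ q ] (1 ≤ q × α ≡ pow (take p α) q)) ×
  (∀ p′ → 0 < p′ → p′ < p → ¬ (∃[ q ] (1 ≤ q × α ≡ pow (take p′ α) q)))

ap : ∀ {A : Set} → List A → ℕ → List A
ap α p = take p α

IsSuffix : ∀ {A : Set} → List A → List A → Set
IsSuffix s a = ∃[ u ] u ++ s ≡ a

-- n / p (p > 0 in all uses)
_/′_ : ℕ → ℕ → ℕ
n /′ zero = 0
n /′ suc p = n / suc p

SameBlock : ℕ → ℕ → ℕ → Set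
SameBlock p c c′ = ∃[ j ] ((j * p < c × c ≤ j * p + p) × (j * p < c′ × c′ ≤ j * p + p))

mutual
  data CJTree (σ : ℕ) : Set where
    node : Str σ → List (Edge σ) → CJTree σ

  -- edge (x , y , β , child): conjugate pair (xβ, yβ)
  Edge : ℕ → Set
  Edge σ = Fin σ × Fin σ × Str σ × CJTree σ

rootNeck : ∀ {σ} → CJTree σ → Str σ
rootNeck (node a _) = a

edgeβ : ∀ {σ} → Edge σ → Str σ
edgeβ (_ , _ , β , _) = β

mutual
  necklaces : ∀ {σ} → CJTree σ → List (Str σ)
  necklaces (node a es) = a ∷ necklacesE es

  necklacesE : ∀ {σ} → List (Edge σ) → List (Str σ)
  necklacesE [] = []
  necklacesE ((_ , _ , _ , t) ∷ es) = necklaces t ++ necklacesE es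

mutual
  data WFTree {σ : ℕ} (n : ℕ) : CJTree σ → Set where
    wf : ∀ {a es} → length a ≡ n → IsNecklace a → WFEdges n a es
       → Unique (map edgeβ es)          -- Chain Property
       → WFTree n (node a es)

  data WFEdges {σ : ℕ} (n : ℕ) (a : Str σ) : List (Edge σ) → Set where
    []  : WFEdges n a []
    _∷_ : ∀ {x y β t es}
        → (x ≢ y × length β ≡ n ∸ 1 × IsRotation (x ∷ β) a
             × IsRotation (y ∷ β) (rootNeck t) × WFTree n t)
        → WFEdges n a es
        → WFEdges n a ((x , y , β , t) ∷ es)

IsCJTree : ∀ {σ} → ℕ → CJTree σ → Set
IsCJTree n t = WFTree n t × Unique (necklaces t)

-- Labelled trees (concatenation trees): label and change index per node,
-- children stored in increasing order of change index

data LTree (σ : ℕ) : Set where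
  lnode : Str σ → ℕ → List (LTree σ) → LTree σ

ciOf : ∀ {σ} → LTree σ → ℕ
ciOf (lnode _ c _) = c

data Side : Set where
  left right : Side

isRight : Side → ℕ → ℕ → Bool
isRight left  c ci = c <ᵇ ci
isRight right c ci = c ≤ᵇ ci

mutual
  data ConcatOf {σ : ℕ} : CJTree σ → Str σ → ℕ → LTree σ → Set where
    mk : ∀ {a es α c ls} (es′ : List (Edge σ))
       → es′ ↭ es
       → ChildrenOf α c es′ ls
       → Linked (λ u v → ciOf u < ciOf v) ls
       → ConcatOf (node a es) α c (lnode α c ls)

  data ChildrenOf {σ : ℕ} (α : Str σ) (c : ℕ) : List (Edge σ) → List (LTree σ) → Set where
    []  : ChildrenOf α c [] []
    cons : ∀ {x y β t es l ls} (β₁ β₂ : Str σ) (p : ℕ)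
         → α ≡ β₁ ++ x ∷ β₂
         → β₂ ++ β₁ ≡ β
         → IsPeriod α p
         → SameBlock p c (suc (length β₁))
         → ConcatOf t (β₁ ++ y ∷ β₂) (suc (length β₁)) l
         → ChildrenOf α c es ls
         → ChildrenOf α c ((x , y , β , t) ∷ es) (l ∷ ls)

IsConcatTree : ∀ {σ} → CJTree σ → ℕ → LTree σ → Set
IsConcatTree t c l = ConcatOf t (rootNeck t) c l

mutual
  rcl : ∀ {σ} → Side → LTree σ → List (Str σ × ℕ)
  rcl s (lnode α c ls) = rclSel s c true ls ++ (α , c) ∷ rclSel s c false ls

  -- concatenation over the right- (b = true) or left- (b = false) children
  rclSel : ∀ {σ} → Side → ℕ → Bool → List (LTree σ) → List (Str σ × ℕ)
  rclSel s c b [] = []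
  rclSel s c b (l ∷ ls) =
    (if isRight s c (ciOf l)
       then (if b then rcl s l else [])
       else (if b then [] else rcl s l))
    ++ rclSel s c b ls

prevIdx : ∀ {t} → Fin t → Fin t
prevIdx {suc t} Fin.zero = fromℕ t
prevIdx {suc t} (Fin.suc i) = inject₁ i

-- Call x ↝ y when the labels of x and y agree from some position e on, where e lies
-- no further than the end of the acceptable block of y.  Walking a concatenation
-- subtree in RCL order from any string agreeing with the root label beyond the root's
-- change index c, every step is a ↝-step and the walk ends again at a string agreeing
-- with the root label beyond c: a right child changes a symbol at an index in the
-- root's block at or after c, a left child one at or before c.  Walking the whole tree
-- twice shows that the cyclic predecessor of every node is ↝-related to it.  If α_j
-- has period p and acceptable block {kp+1, …, kp+p}, then α_{j-1} agrees with
-- α_j = ap(α_j)^(n/p) from position kp+p on, which is the claimed suffix.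
module Submission where

open import Defs
open import Data.Nat using (ℕ; zero; suc; _+_; _*_; _∸_; _<_; _≤_; z≤n)
open import Data.Nat.Properties
open import Data.Nat.DivMod using (m*n/n≡m)
open import Data.Fin using (Fin; fromℕ; inject₁)
import Data.Fin as Fin
open import Data.Bool using (true; false; T)
import Data.Bool as Bool
open import Data.Empty using (⊥-elim)
open import Data.List using (List; []; _∷_; _++_; length; lookup; take; drop)
open import Data.List.Properties using (length-++; length-take; drop-drop; drop-[]; take++drop≡id)
open import Data.List.Membership.Propositional.Properties using (∈-lookup)
open import Data.List.Relation.Unary.All as All using (All; []; _∷_)
open import Data.List.Relation.Unary.All.Properties using (++⁺)
open import Data.List.Relation.Unary.AllPairs using (AllPairs; []; _∷_)
open import Data.List.Relation.Unary.Linked using (Linked)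
open import Data.List.Relation.Unary.Linked.Properties using (Linked⇒AllPairs)
open import Data.Product using (_×_; proj₁; proj₂; _,_; ∃; ∃₂)
open import Relation.Binary.PropositionalEquality
open import Relation.Nullary using (¬_; yes; no)

AgreeBeyond : ∀ {A : Set} → ℕ → List A → List A → Set
AgreeBeyond e xs ys = drop e xs ≡ drop e ys

agreeBeyond-mono : ∀ {A : Set} {e d} {xs ys : List A} →
                   e ≤ d → AgreeBeyond e xs ys → AgreeBeyond d xs ys
agreeBeyond-mono {e = e} {d} {xs} {ys} e≤d xs≈ys = begin
  drop d xs                ≡⟨ cong (λ m → drop m xs) (sym (m+[n∸m]≡n e≤d)) ⟩
  drop (e + (d ∸ e)) xs    ≡⟨ sym (drop-drop e (d ∸ e) xs) ⟩
  drop (d ∸ e) (drop e xs) ≡⟨ cong (drop (d ∸ e)) xs≈ys ⟩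
  drop (d ∸ e) (drop e ys) ≡⟨ drop-drop e (d ∸ e) ys ⟩
  drop (e + (d ∸ e)) ys    ≡⟨ cong (λ m → drop m ys) (m+[n∸m]≡n e≤d) ⟩
  drop d ys                ∎
  where open ≡-Reasoning

agreeBeyond-substitution : ∀ {A : Set} (β₁ : List A) x y β₂ →
                           AgreeBeyond (suc (length β₁)) (β₁ ++ x ∷ β₂) (β₁ ++ y ∷ β₂)
agreeBeyond-substitution []       x y β₂ = refl
agreeBeyond-substitution (_ ∷ β₁) x y β₂ = agreeBeyond-substitution β₁ x y β₂

length-pow : ∀ {A : Set} (a : List A) q → length (pow a q) ≡ q * length a
length-pow a zero    = refl
length-pow a (suc q) = trans (length-++ a) (cong (length a +_) (length-pow a q))

drop-length-++ : ∀ {A : Set} (a r : List A) → drop (length a) (a ++ r) ≡ r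
drop-length-++ []      r = refl
drop-length-++ (_ ∷ a) r = drop-length-++ a r

drop-pow : ∀ {A : Set} (a : List A) q m → drop (m * length a) (pow a q) ≡ pow a (q ∸ m)
drop-pow a q       zero    = refl
drop-pow a zero    (suc m) = drop-[] (suc m * length a)
drop-pow a (suc q) (suc m) = begin
  drop (length a + m * length a) (a ++ pow a q)
    ≡⟨ sym (drop-drop (length a) (m * length a) (a ++ pow a q)) ⟩
  drop (m * length a) (drop (length a) (a ++ pow a q))
    ≡⟨ cong (drop (m * length a)) (drop-length-++ a (pow a q)) ⟩
  drop (m * length a) (pow a q)
    ≡⟨ drop-pow a q m ⟩
  pow a (q ∸ m) ∎
  where open ≡-Reasoning

*-/′-cancelʳ : ∀ q {p} → 0 < p → (q * p) /′ p ≡ q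
*-/′-cancelʳ q {suc p} _ = m*n/n≡m q (suc p)

period-unique : ∀ {A : Set} {α : List A} {p p′} → IsPeriod α p → IsPeriod α p′ → p ≡ p′
period-unique (p>0 , rootₚ , minimalₚ) (p′>0 , rootₚ′ , minimalₚ′) =
  ≤-antisym (≮⇒≥ (λ p′<p → minimalₚ _ p′>0 p′<p rootₚ′))
            (≮⇒≥ (λ p<p′ → minimalₚ′ _ p>0 p<p′ rootₚ))

block-unique : ∀ {j k p c} → j * p < c → c ≤ j * p + p → k * p < c → c ≤ k * p + p → j ≡ k
block-unique jp<c c≤jp+p kp<c c≤kp+p =
  ≤-antisym (≮⇒≥ (block-below c≤kp+p jp<c)) (≮⇒≥ (block-below c≤jp+p kp<c))
  where
    block-below : ∀ {i l p c} → c ≤ i * p + p → l * p < c → ¬ (i < l)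
    block-below {i} {l} {p} c≤ip+p lp<c i<l =
      <-irrefl refl (<-≤-trans lp<c (≤-trans c≤ip+p (≤-trans (≤-reflexive (+-comm (i * p) p))
                                                                (*-monoˡ-≤ p i<l))))

_≤blockEnd_ : ∀ {σ} → ℕ → Str σ × ℕ → Set
e ≤blockEnd (α , c) = ∀ p k → IsPeriod α p → k * p < c → c ≤ k * p + p → e ≤ k * p + p

sameBlock⇒≤blockEnd : ∀ {σ} {α : Str σ} {p c e} →
                      IsPeriod α p → SameBlock p c e → e ≤blockEnd (α , c)
sameBlock⇒≤blockEnd period (j , (jp<c , c≤jp+p) , (_ , e≤jp+p)) _ k period′ kp<c c≤kp+p
  with period-unique period period′
... | refl with block-unique {j} {k} jp<c c≤jp+p kp<c c≤kp+p
... | refl = e≤jp+p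

_↝_ : ∀ {σ} → Str σ × ℕ → Str σ × ℕ → Set
x ↝ y = ∃ λ e → AgreeBeyond e (proj₁ x) (proj₁ y) × e ≤blockEnd y

↝-suffix : ∀ {σ} {x y : Str σ × ℕ} {n p k} →
           length (proj₁ y) ≡ n → IsPeriod (proj₁ y) p → p < n →
           k * p < proj₂ y → proj₂ y ≤ k * p + p → x ↝ y →
           IsSuffix (pow (ap (proj₁ y) p) (n /′ p ∸ k ∸ 1)) (proj₁ x)
↝-suffix {σ} {x = β , _} {y = α , _} {n} {p} {k}
         |α|≡n period@(p>0 , (q , _ , α≡aᵠ) , _) p<n kp<c c≤kp+p (e , β≈α , e≤end) =
  take B β , (begin
    take B β ++ pow a (n /′ p ∸ k ∸ 1) ≡⟨ cong (λ r → take B β ++ pow a r) exponent ⟩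
    take B β ++ pow a (q ∸ suc k)      ≡⟨ cong (take B β ++_) (sym tail) ⟩
    take B β ++ drop B β               ≡⟨ take++drop≡id B β ⟩
    β                                  ∎)
  where
    open ≡-Reasoning
    a : Str σ
    a = ap α p

    B : ℕ
    B = k * p + p

    |a|≡p : length a ≡ p
    |a|≡p = trans (length-take p α) (m≤n⇒m⊓n≡m (≤-trans (<⇒≤ p<n) (≤-reflexive (sym |α|≡n))))

    n≡q*p : n ≡ q * p
    n≡q*p = begin
      n                ≡⟨ sym |α|≡n ⟩
      length α         ≡⟨ cong length α≡aᵠ ⟩
      length (pow a q) ≡⟨ length-pow a q ⟩
      q * length a     ≡⟨ cong (q *_) |a|≡p ⟩
      q * p            ∎

    exponent : n /′ p ∸ k ∸ 1 ≡ q ∸ suc k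
    exponent = begin
      n /′ p ∸ k ∸ 1       ≡⟨ cong (λ m → m /′ p ∸ k ∸ 1) n≡q*p ⟩
      (q * p) /′ p ∸ k ∸ 1 ≡⟨ cong (λ m → m ∸ k ∸ 1) (*-/′-cancelʳ q p>0) ⟩
      q ∸ k ∸ 1            ≡⟨ ∸-+-assoc q k 1 ⟩
      q ∸ (k + 1)          ≡⟨ cong (q ∸_) (+-comm k 1) ⟩
      q ∸ suc k            ∎

    tail : drop B β ≡ pow a (q ∸ suc k)
    tail = begin
      drop B β                          ≡⟨ agreeBeyond-mono (e≤end p k period kp<c c≤kp+p) β≈α ⟩
      drop B α                          ≡⟨ cong (drop B) α≡aᵠ ⟩
      drop B (pow a q)                  ≡⟨ cong (λ m → drop m (pow a q)) B≡suc[k]*|a| ⟩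
      drop (suc k * length a) (pow a q) ≡⟨ drop-pow a q (suc k) ⟩
      pow a (q ∸ suc k)                 ∎
      where
        B≡suc[k]*|a| : B ≡ suc k * length a
        B≡suc[k]*|a| = trans (+-comm (k * p) p) (cong (suc k *_) (sym |a|≡p))

data Chain {A : Set} (R : A → A → Set) (z : A) : List A → A → Set where
  []  : Chain R z [] z
  _∷_ : ∀ {y ys w} → R z y → Chain R y ys w → Chain R z (y ∷ ys) w

_++ᶜ_ : ∀ {A : Set} {R : A → A → Set} {z w v xs ys} →
        Chain R z xs w → Chain R w ys v → Chain R z (xs ++ ys) v
[]       ++ᶜ later = later
(r ∷ rs) ++ᶜ later = r ∷ (rs ++ᶜ later)

chain-lookup : ∀ {A : Set} {R : A → A → Set} {z w xs} → Chain R z xs w →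
               (j : Fin (length xs)) → R (lookup (z ∷ xs) (inject₁ j)) (lookup xs j)
chain-lookup (r ∷ _)  Fin.zero    = r
chain-lookup (_ ∷ rs) (Fin.suc j) = chain-lookup rs j

chain-last : ∀ {A : Set} {R : A → A → Set} {z w y} ys → Chain R z (y ∷ ys) w →
             lookup (y ∷ ys) (fromℕ (length ys)) ≡ w
chain-last []       (_ ∷ [])  = refl
chain-last (_ ∷ ys) (_ ∷ rs) = chain-last ys rs

chain-cyclic : ∀ {A : Set} {R : A → A → Set} {z w w′ xs} →
               Chain R z xs w → Chain R w xs w′ →
               (j : Fin (length xs)) → R (lookup xs (prevIdx j)) (lookup xs j)
chain-cyclic {R = R} {xs = y ∷ ys} first (r ∷ _) Fin.zero =
  subst (λ v → R v y) (sym (chain-last ys first)) r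
chain-cyclic {xs = _ ∷ _} first second (Fin.suc j) = chain-lookup second (Fin.suc j)

isRight-true⇒≥ : ∀ s c ci → isRight s c ci ≡ true → c ≤ ci
isRight-true⇒≥ left  c ci h = <⇒≤ (<ᵇ⇒< c ci (subst T (sym h) _))
isRight-true⇒≥ right c ci h = ≤ᵇ⇒≤ c ci (subst T (sym h) _)

isRight-false⇒≤ : ∀ s c ci → isRight s c ci ≡ false → ci ≤ c
isRight-false⇒≤ left  c ci h = ≮⇒≥ (λ c<ci → subst T h (<⇒<ᵇ c<ci))
isRight-false⇒≤ right c ci h = <⇒≤ (≰⇒> (λ c≤ci → subst T h (≤⇒≤ᵇ c≤ci)))

rclSel-selected : ∀ {σ} s c b (l : LTree σ) ls →
                  isRight s c (ciOf l) ≡ b → rclSel s c b (l ∷ ls) ≡ rcl s l ++ rclSel s c b ls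
rclSel-selected s c b l ls selected with isRight s c (ciOf l)
rclSel-selected s c .true  l ls refl | true  = refl
rclSel-selected s c .false l ls refl | false = refl

rclSel-skipped : ∀ {σ} s c b (l : LTree σ) ls →
                 isRight s c (ciOf l) ≢ b → rclSel s c b (l ∷ ls) ≡ rclSel s c b ls
rclSel-skipped s c b l ls skipped with isRight s c (ciOf l) | b
... | true  | true  = ⊥-elim (skipped refl)
... | true  | false = refl
... | false | true  = refl
... | false | false = ⊥-elim (skipped refl)

rclSel-all : ∀ {σ} {P : Str σ × ℕ → Set} s c b (ls : List (LTree σ)) →
             All (λ l → All P (rcl s l)) ls → All P (rclSel s c b ls)
rclSel-all s c b []       []         = []
rclSel-all {P = P} s c b (l ∷ ls) (pl ∷ pls) with isRight s c (ciOf l) Bool.≟ b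
... | yes selected = subst (All P) (sym (rclSel-selected s c b l ls selected))
                           (++⁺ pl (rclSel-all s c b ls pls))
... | no  skipped  = subst (All P) (sym (rclSel-skipped s c b l ls skipped))
                           (rclSel-all s c b ls pls)

mutual
  rcl-labels-length : ∀ {σ} s {t α c L} → ConcatOf {σ} t α c L →
                      All (λ x → length (proj₁ x) ≡ length α) (rcl s L)
  rcl-labels-length s {c = c} (mk _ _ children _) =
    ++⁺ (rclSel-all s c true _ (children-labels-length s children))
        (refl ∷ rclSel-all s c false _ (children-labels-length s children))

  children-labels-length : ∀ {σ} s {α c es ls} → ChildrenOf {σ} α c es ls →
                           All (λ l → All (λ x → length (proj₁ x) ≡ length α) (rcl s l)) ls
  children-labels-length s [] = []
  children-labels-length s (cons β₁ β₂ _ refl _ _ _ child children) =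
    All.map (λ h → trans h (trans (length-++ β₁) (sym (length-++ β₁)))) (rcl-labels-length s child)
    ∷ children-labels-length s children

children-within-block : ∀ {σ} {α c es ls} → ChildrenOf {σ} α c es ls →
                        All (λ l → ciOf l ≤blockEnd (α , c)) ls
children-within-block [] = []
children-within-block (cons _ _ _ _ _ period sameBlock (mk _ _ _ _) children) =
  sameBlock⇒≤blockEnd period sameBlock ∷ children-within-block children

ChainAgreeingWith : ∀ {σ} → (ℕ → Set) → Str σ → Str σ × ℕ → List (Str σ × ℕ) → Set
ChainAgreeingWith Q α z xs =
  ∃₂ λ w e → Q e × AgreeBeyond e (proj₁ w) α × Chain _↝_ z xs w

mutual
  concat-chain : ∀ {σ} s {t α c L} → ConcatOf {σ} t α c L →
                 ∀ z → AgreeBeyond c (proj₁ z) α →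
                 ∃ λ w → AgreeBeyond c (proj₁ w) α × Chain _↝_ z (rcl s L) w
  concat-chain s {α = α} {c} (mk _ _ children ordered) z z≈α
    with right-children-chain s children ordered z z≈α
       | left-children-chain s children ordered
  ... | w₁ , e₁ , e₁≤end , w₁≈α , rights | w₂ , e₂ , e₂≤c , w₂≈α , lefts =
    w₂ , agreeBeyond-mono e₂≤c w₂≈α , rights ++ᶜ ((e₁ , w₁≈α , e₁≤end) ∷ lefts)

  right-children-chain : ∀ {σ} s {α c es ls} → ChildrenOf {σ} α c es ls →
                         Linked (λ u v → ciOf u < ciOf v) ls →
                         ∀ z → AgreeBeyond c (proj₁ z) α →
                         ChainAgreeingWith (_≤blockEnd (α , c)) α z (rclSel s c true ls)
  right-children-chain s {α} {c} children ordered z z≈α =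
    children-chain s true (_≤blockEnd (α , c)) children (Linked⇒AllPairs <-trans ordered)
      (All.map (λ inBlock _ → inBlock) (children-within-block children))
      z c (λ _ _ _ _ c≤end → c≤end) z≈α
      (All.universal (λ l → isRight-true⇒≥ s c (ciOf l)) _)

  left-children-chain : ∀ {σ} s {α c es ls} → ChildrenOf {σ} α c es ls →
                        Linked (λ u v → ciOf u < ciOf v) ls →
                        ChainAgreeingWith (_≤ c) α (α , c) (rclSel s c false ls)
  left-children-chain s {c = c} children ordered =
    children-chain s false (_≤ c) children (Linked⇒AllPairs <-trans ordered)
      (All.universal (λ l → isRight-false⇒≤ s c (ciOf l)) _)
      (_ , c) 0 z≤n refl (All.universal (λ _ _ → z≤n) _)

  children-chain : ∀ {σ} s b (Q : ℕ → Set) {α c es ls} → ChildrenOf {σ} α c es ls →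
                   AllPairs (λ u v → ciOf u < ciOf v) ls →
                   All (λ l → isRight s c (ciOf l) ≡ b → Q (ciOf l)) ls →
                   ∀ z e → Q e → AgreeBeyond e (proj₁ z) α →
                   All (λ l → isRight s c (ciOf l) ≡ b → e ≤ ciOf l) ls →
                   ChainAgreeingWith Q α z (rclSel s c b ls)
  children-chain s b Q [] _ _ z e qe z≈α _ = z , e , qe , z≈α , []
  children-chain s b Q {α} {c} (cons {x = x} {y} {l = l} {ls} β₁ β₂ _ refl _ _ _ child children)
                 (l<ls ∷ ordered) (ql ∷ qls) z e qe z≈α (e≤l ∷ e≤ls)
    with isRight s c (ciOf l) Bool.≟ b
  ... | no skipped =
    subst (ChainAgreeingWith Q α z) (sym (rclSel-skipped s c b l ls skipped))
      (children-chain s b Q children ordered qls z e qe z≈α e≤ls)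
  ... | yes selected =
    subst (ChainAgreeingWith Q α z) (sym (rclSel-selected s c b l ls selected))
      (child-chain s b Q child (agreeBeyond-substitution β₁ x y β₂) (ql selected)
         children ordered qls l<ls z (agreeBeyond-mono (e≤l selected) z≈α))

  child-chain : ∀ {σ} s b (Q : ℕ → Set) {t α α′ c ci l es ls} →
                ConcatOf {σ} t α′ ci l → AgreeBeyond ci α α′ → Q (ciOf l) →
                ChildrenOf α c es ls → AllPairs (λ u v → ciOf u < ciOf v) ls →
                All (λ l → isRight s c (ciOf l) ≡ b → Q (ciOf l)) ls →
                All (λ v → ciOf l < ciOf v) ls →
                ∀ z → AgreeBeyond (ciOf l) (proj₁ z) α →
                ChainAgreeingWith Q α z (rcl s l ++ rclSel s c b ls)
  child-chain s b Q {ci = ci} child@(mk _ _ _ _) α≈α′ qci children ordered qls ci<ls z z≈α =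
    let w₁ , w₁≈α′ , within = concat-chain s child z (trans z≈α α≈α′)
        w , e , qe , w≈α , rest =
          children-chain s b Q children ordered qls w₁ ci qci (trans w₁≈α′ (sym α≈α′))
            (All.map (λ ci<l _ → <⇒≤ ci<l) ci<ls)
    in w , e , qe , w≈α , within ++ᶜ rest

lemma7 : ∀ {σ : ℕ} (n : ℕ) (T : CJTree σ) → IsCJTree n T
       → (c : ℕ) → 1 ≤ c → c ≤ n → (ℓ : Side)
       → (L : LTree σ) → IsConcatTree T c L
       → (j : Fin (length (rcl ℓ L)))
       → (p k : ℕ)
       → IsPeriod (proj₁ (lookup (rcl ℓ L) j)) p → p < n
       → k * p < proj₂ (lookup (rcl ℓ L) j)
       → proj₂ (lookup (rcl ℓ L) j) ≤ k * p + p
       → IsSuffix (pow (ap (proj₁ (lookup (rcl ℓ L) j)) p) (n /′ p ∸ k ∸ 1))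
                  (proj₁ (lookup (rcl ℓ L) (prevIdx j)))
lemma7 n (node a _) (wf |a|≡n _ _ _ , _) c _ _ ℓ L concatTree j p k period p<n kp<c c≤kp+p
  with concat-chain ℓ concatTree (a , c) refl
... | w₁ , w₁≈a , firstRound
  with concat-chain ℓ concatTree w₁ w₁≈a
... | _ , _ , secondRound =
  ↝-suffix {x = lookup (rcl ℓ L) (prevIdx j)} {k = k} |αⱼ|≡n period p<n kp<c c≤kp+p
           (chain-cyclic firstRound secondRound j)
  where
    |αⱼ|≡n : length (proj₁ (lookup (rcl ℓ L) j)) ≡ n
    |αⱼ|≡n = trans (All.lookup (rcl-labels-length ℓ concatTree) (∈-lookup j)) |a|≡n
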